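{- For every rooted tree $T$ with root $r$, $$\Delta(T)\ge \tfrac12\log_2 s(T).$$
   Context: A subtree of a tree is a (nonempty) induced connected subgraph. For a rooted tree $T$ with root $r$, $s(T)$ denotes the number of subtrees of $T$ containing $r$, $t(T)$ denotes the total number of vertices of these subtrees (summed over all of them), and the defect is $\Delta(T)=|T|-\frac{t(T)}{s(T)}$, where $|T|$ is the number of vertices of $T$. -}

module Defs where

open import Data.Nat using (ℕ; zero; suc; _+_; _*_; _^_; _≤_)
open import Data.List using (List; []; _∷_; [_]; map; concatMap; length)
open import Data.Nat.ListAction using (sum)

data RTree : Set where
  node : List RTree → RTree

mutual
  size : RTree → ℕ
  size (node ts) = suc (sizes ts)

  sizes : List RTree → ℕ
  sizes [] = 0
  sizes (t ∷ ts) = size t + sizes ts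

-- Explicit enumeration (with multiplicity, one entry per vertex set) of the
-- subtrees (induced connected subgraphs) of T containing the root r,
-- each returned as a rooted tree.  Such a subtree consists of r together
-- with, for each child c of r, either nothing from the branch at c, or a
-- subtree of that branch containing c.
mutual
  rootSubtrees : RTree → List RTree
  rootSubtrees (node ts) = map node (choices ts)

  choices : List RTree → List (List RTree)
  choices [] = [ [] ]
  choices (t ∷ ts) =
    concatMap (λ rest → rest ∷ map (_∷ rest) (rootSubtrees t)) (choices ts)

s : RTree → ℕ
s T = length (rootSubtrees T)

t : RTree → ℕ
t T = sum (map size (rootSubtrees T))

{-# OPTIONS --safe #-}
module Submission where

-- Write Δ(c, u, n) = n − u/c for a family of c vertex sets of total size u
-- inside an n-vertex forest.  The root subtrees of a forest are the products
-- of independent choices in its branches, so both ½ log₂ s and Δ are additive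
-- over branches, and attaching a root leaves Δ unchanged.  A single branch
-- x contributes the root subtrees of x plus the empty choice; passing from
-- s(x) = a to a + 1 choices raises Δ by t(x)/(a(a+1)) ≥ 1/(a+1) (as t(x) ≥ a),
-- which pays for ½ log₂((a+1)/a) because (1 + 1/a)^(a+1) ≤ 4: by Bernoulli's
-- inequality this sequence decreases, and it equals 4 at a = 1.

open import Defs
open import Data.Nat
open import Data.Nat.Properties
open import Data.Nat.Tactic.RingSolver using (solve-∀)
open import Data.Nat.ListAction using (sum)
open import Data.Nat.ListAction.Properties using (sum-++)
open import Data.List using (List; []; _∷_; _++_; map; concatMap; length)
open import Data.List.Properties using (length-++; length-map; map-++)
open import Relation.Binary.PropositionalEquality
open import Algebra.Properties.CommutativeSemigroup *-commutativeSemigroup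
  using (interchange; x∙yz≈y∙xz; xy∙z≈x∙zy; xy∙z≈xz∙y; xy∙z≈y∙xz)

^-distribʳ-* : ∀ m n o → (m * n) ^ o ≡ m ^ o * n ^ o
^-distribʳ-* m n zero    = refl
^-distribʳ-* m n (suc o) = begin
  m * n * (m * n) ^ o     ≡⟨ cong (m * n *_) (^-distribʳ-* m n o) ⟩
  m * n * (m ^ o * n ^ o) ≡⟨ interchange m n (m ^ o) (n ^ o) ⟩
  m * m ^ o * (n * n ^ o) ∎
  where open ≡-Reasoning

^-*-assoc′ : ∀ m n o → m ^ (n * o) ≡ (m ^ o) ^ n
^-*-assoc′ m n o = trans (cong (m ^_) (*-comm n o)) (sym (^-*-assoc m o n))

^-^-comm : ∀ m n o → (m ^ n) ^ o ≡ (m ^ o) ^ n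
^-^-comm m n o = trans (^-*-assoc m n o) (^-*-assoc′ m n o)

^-cancelʳ-≤ : ∀ m n o .{{_ : NonZero o}} → m ^ o ≤ n ^ o → m ≤ n
^-cancelʳ-≤ m n o mᵒ≤nᵒ = ≮⇒≥ (λ n<m → <⇒≱ (^-monoˡ-< o n<m) mᵒ≤nᵒ)

bernoulli : ∀ q m → q ^ m * (q + suc m) ≤ suc q ^ suc m
bernoulli q zero    = ≤-reflexive (base q)
  where
  base : ∀ q → 1 * (q + 1) ≡ suc q * 1
  base = solve-∀
bernoulli q (suc m) = begin
  q * q ^ m * (q + suc (suc m))         ≡⟨ expand q (q ^ m) m ⟩
  q * (q ^ m * (q + suc m)) + q ^ suc m
    ≤⟨ +-mono-≤ (*-monoʳ-≤ q (bernoulli q m)) (^-monoˡ-≤ (suc m) (n≤1+n q)) ⟩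
  q * suc q ^ suc m + suc q ^ suc m     ≡⟨ +-comm (q * suc q ^ suc m) (suc q ^ suc m) ⟩
  suc q * suc q ^ suc m                 ∎
  where
  open ≤-Reasoning
  expand : ∀ q x m → q * x * (q + suc (suc m)) ≡ q * (x * (q + suc m)) + q * x
  expand = solve-∀

-- Bernoulli's inequality at q = n(n+2), where q + 1 = (n+1)².
[1+1/n]^[1+n]-decreasing : ∀ n →
  (2 + n) ^ (2 + n) * n ^ (1 + n) ≤ (1 + n) ^ (1 + n) * (1 + n) ^ (2 + n)
[1+1/n]^[1+n]-decreasing n = begin
  (2 + n) ^ (2 + n) * n ^ (1 + n)         ≡⟨ regroup n ((2 + n) ^ n) (n ^ n) ⟩
  (2 + n) * Q * (n ^ n * (2 + n) ^ n)     ≡⟨ cong ((2 + n) * Q *_) (^-distribʳ-* n (2 + n) n) ⟨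
  (2 + n) * Q * Q ^ n
    ≤⟨ *-monoˡ-≤ (Q ^ n) (≤-trans (n≤1+n _) (≤-reflexive (cube n))) ⟩
  (1 + n) * (Q + suc n) * Q ^ n           ≡⟨ xy∙z≈x∙zy (1 + n) (Q + suc n) (Q ^ n) ⟩
  (1 + n) * (Q ^ n * (Q + suc n))         ≤⟨ *-monoʳ-≤ (1 + n) (bernoulli Q n) ⟩
  (1 + n) * suc Q ^ suc n                 ≡⟨ cong (λ x → (1 + n) * x ^ suc n) (square n) ⟩
  (1 + n) * ((1 + n) * (1 + n)) ^ (1 + n)
    ≡⟨ cong ((1 + n) *_) (^-distribʳ-* (1 + n) (1 + n) (1 + n)) ⟩
  (1 + n) * ((1 + n) ^ (1 + n) * (1 + n) ^ (1 + n))
    ≡⟨ x∙yz≈y∙xz (1 + n) ((1 + n) ^ (1 + n)) ((1 + n) ^ (1 + n)) ⟩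
  (1 + n) ^ (1 + n) * (1 + n) ^ (2 + n)   ∎
  where
  open ≤-Reasoning
  Q = n * (2 + n)
  regroup : ∀ n p r → (2 + n) * ((2 + n) * p) * (n * r) ≡ (2 + n) * (n * (2 + n)) * (r * p)
  regroup = solve-∀
  cube : ∀ n → 1 + (2 + n) * (n * (2 + n)) ≡ (1 + n) * (n * (2 + n) + suc n)
  cube = solve-∀
  square : ∀ n → suc (n * (2 + n)) ≡ (1 + n) * (1 + n)
  square = solve-∀

[1+1/n]^[1+n]≤4 : ∀ n .{{_ : NonZero n}} → (1 + n) ^ (1 + n) ≤ 4 * n ^ (1 + n)
[1+1/n]^[1+n]≤4 1             = ≤-refl
[1+1/n]^[1+n]≤4 (suc n@(suc _)) = *-cancelʳ-≤ _ _ (n ^ (1 + n)) {{m^n≢0 n (1 + n)}} (begin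
  (2 + n) ^ (2 + n) * n ^ (1 + n)         ≤⟨ [1+1/n]^[1+n]-decreasing n ⟩
  (1 + n) ^ (1 + n) * (1 + n) ^ (2 + n)   ≤⟨ *-monoˡ-≤ _ ([1+1/n]^[1+n]≤4 n) ⟩
  4 * n ^ (1 + n) * (1 + n) ^ (2 + n)     ≡⟨ xy∙z≈xz∙y 4 (n ^ (1 + n)) ((1 + n) ^ (2 + n)) ⟩
  4 * (1 + n) ^ (2 + n) * n ^ (1 + n)     ∎)
  where open ≤-Reasoning

-- c ^ c * 4 ^ u ≤ 4 ^ (n * c) is  ½ log₂ c ≤ n − u/c  multiplied by 2c and exponentiated.
record DefectBound (c u n : ℕ) : Set where
  constructor defectBound
  field bound : c ^ c * 4 ^ u ≤ 4 ^ (n * c)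

DefectBound-root : ∀ {c u n} → DefectBound c u n → DefectBound c (c + u) (suc n)
DefectBound-root {c} {u} {n} (defectBound bound) = defectBound (begin
  c ^ c * 4 ^ (c + u)     ≡⟨ cong (c ^ c *_) (^-distribˡ-+-* 4 c u) ⟩
  c ^ c * (4 ^ c * 4 ^ u) ≡⟨ x∙yz≈y∙xz (c ^ c) (4 ^ c) (4 ^ u) ⟩
  4 ^ c * (c ^ c * 4 ^ u) ≤⟨ *-monoʳ-≤ (4 ^ c) bound ⟩
  4 ^ c * 4 ^ (n * c)     ≡⟨ ^-distribˡ-+-* 4 c (n * c) ⟨
  4 ^ (suc n * c)         ∎)
  where open ≤-Reasoning

DefectBound-* : ∀ {c u n d v m} → DefectBound c u n → DefectBound d v m →
                DefectBound (c * d) (d * u + c * v) (n + m)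
DefectBound-* {c} {u} {n} {d} {v} {m} (defectBound bound₁) (defectBound bound₂) =
  defectBound (begin
  (c * d) ^ (c * d) * 4 ^ (d * u + c * v)   ≡⟨ split ⟩
  (c ^ c * 4 ^ u) ^ d * (d ^ d * 4 ^ v) ^ c ≤⟨ *-mono-≤ (^-monoˡ-≤ d bound₁) (^-monoˡ-≤ c bound₂) ⟩
  (4 ^ (n * c)) ^ d * (4 ^ (m * d)) ^ c     ≡⟨ merge ⟩
  4 ^ ((n + m) * (c * d))                   ∎)
  where
  open ≤-Reasoning
  split : (c * d) ^ (c * d) * 4 ^ (d * u + c * v) ≡ (c ^ c * 4 ^ u) ^ d * (d ^ d * 4 ^ v) ^ c
  split = begin-equality
    (c * d) ^ (c * d) * 4 ^ (d * u + c * v)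
      ≡⟨ cong₂ _*_ (^-distribʳ-* c d (c * d)) (^-distribˡ-+-* 4 (d * u) (c * v)) ⟩
    c ^ (c * d) * d ^ (c * d) * (4 ^ (d * u) * 4 ^ (c * v))
      ≡⟨ interchange (c ^ (c * d)) (d ^ (c * d)) (4 ^ (d * u)) (4 ^ (c * v)) ⟩
    c ^ (c * d) * 4 ^ (d * u) * (d ^ (c * d) * 4 ^ (c * v))
      ≡⟨ cong₂ _*_ (cong₂ _*_ (sym (^-*-assoc c c d)) (^-*-assoc′ 4 d u))
                   (cong₂ _*_ (^-*-assoc′ d c d) (^-*-assoc′ 4 c v)) ⟩
    (c ^ c) ^ d * (4 ^ u) ^ d * ((d ^ d) ^ c * (4 ^ v) ^ c)
      ≡⟨ cong₂ _*_ (^-distribʳ-* (c ^ c) (4 ^ u) d) (^-distribʳ-* (d ^ d) (4 ^ v) c) ⟨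
    (c ^ c * 4 ^ u) ^ d * (d ^ d * 4 ^ v) ^ c ∎
  merge : (4 ^ (n * c)) ^ d * (4 ^ (m * d)) ^ c ≡ 4 ^ ((n + m) * (c * d))
  merge = begin-equality
    (4 ^ (n * c)) ^ d * (4 ^ (m * d)) ^ c ≡⟨ cong₂ _*_ (^-*-assoc 4 (n * c) d) (^-*-assoc 4 (m * d) c) ⟩
    4 ^ (n * c * d) * 4 ^ (m * d * c)     ≡⟨ ^-distribˡ-+-* 4 (n * c * d) (m * d * c) ⟨
    4 ^ (n * c * d + m * d * c)           ≡⟨ cong (4 ^_) (exponent n m c d) ⟩
    4 ^ ((n + m) * (c * d))               ∎
    where
    exponent : ∀ n m c d → n * c * d + m * d * c ≡ (n + m) * (c * d)
    exponent = solve-∀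

DefectBound-branch : ∀ {a b n} → a ≤ b → DefectBound a b n → DefectBound (suc a) b n
DefectBound-branch {zero}      {b} {n} _   (defectBound bound) =
  defectBound (≤-trans bound (^-monoʳ-≤ 4 (*-monoʳ-≤ n z≤n)))
DefectBound-branch {a@(suc _)} {b} {n} a≤b (defectBound bound) =
  defectBound (^-cancelʳ-≤ _ _ a (begin
  ((1 + a) ^ (1 + a) * 4 ^ b) ^ a         ≡⟨ ^-distribʳ-* ((1 + a) ^ (1 + a)) (4 ^ b) a ⟩
  ((1 + a) ^ (1 + a)) ^ a * (4 ^ b) ^ a   ≤⟨ *-monoˡ-≤ _ (^-monoˡ-≤ a ([1+1/n]^[1+n]≤4 a)) ⟩
  (4 * a ^ (1 + a)) ^ a * (4 ^ b) ^ a     ≡⟨ cong (_* (4 ^ b) ^ a) (^-distribʳ-* 4 (a ^ (1 + a)) a) ⟩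
  4 ^ a * (a ^ (1 + a)) ^ a * (4 ^ b) ^ a ≤⟨ *-monoˡ-≤ _ (*-monoˡ-≤ _ (^-monoʳ-≤ 4 a≤b)) ⟩
  4 ^ b * (a ^ (1 + a)) ^ a * (4 ^ b) ^ a
    ≡⟨ cong (λ x → 4 ^ b * x * (4 ^ b) ^ a) (^-^-comm a (1 + a) a) ⟩
  4 ^ b * (a ^ a) ^ (1 + a) * (4 ^ b) ^ a ≡⟨ xy∙z≈y∙xz (4 ^ b) ((a ^ a) ^ (1 + a)) ((4 ^ b) ^ a) ⟩
  (a ^ a) ^ (1 + a) * (4 ^ b) ^ (1 + a)   ≡⟨ ^-distribʳ-* (a ^ a) (4 ^ b) (1 + a) ⟨
  (a ^ a * 4 ^ b) ^ (1 + a)               ≤⟨ ^-monoˡ-≤ (1 + a) bound ⟩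
  (4 ^ (n * a)) ^ (1 + a)                 ≡⟨ ^-*-assoc 4 (n * a) (1 + a) ⟩
  4 ^ (n * a * (1 + a))                   ≡⟨ cong (4 ^_) (xy∙z≈xz∙y n a (1 + a)) ⟩
  4 ^ (n * (1 + a) * a)                   ≡⟨ ^-*-assoc 4 (n * (1 + a)) a ⟨
  (4 ^ (n * (1 + a))) ^ a                 ∎))
  where open ≤-Reasoning

-- choices (t ∷ ts) is definitionally concatMap (extensions (rootSubtrees t)) (choices ts).
extensions : List RTree → List RTree → List (List RTree)
extensions R rest = rest ∷ map (_∷ rest) R

length-concatMap-extensions : ∀ R L → length (concatMap (extensions R) L) ≡ suc (length R) * length L
length-concatMap-extensions R []      = sym (*-zeroʳ (suc (length R)))
length-concatMap-extensions R (r ∷ L) = begin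
  length (extensions R r ++ concatMap (extensions R) L)       ≡⟨ length-++ (extensions R r) ⟩
  suc (length (map (_∷ r) R)) + length (concatMap (extensions R) L)
    ≡⟨ cong₂ (λ l k → suc l + k) (length-map (_∷ r) R) (length-concatMap-extensions R L) ⟩
  suc (length R) + suc (length R) * length L                  ≡⟨ *-suc (suc (length R)) (length L) ⟨
  suc (length R) * suc (length L)                             ∎
  where open ≡-Reasoning

sum-sizes-map-∷ : ∀ rest (R : List RTree) →
                  sum (map sizes (map (_∷ rest) R)) ≡ sum (map size R) + length R * sizes rest
sum-sizes-map-∷ rest []      = refl
sum-sizes-map-∷ rest (x ∷ R) = begin
  size x + sizes rest + sum (map sizes (map (_∷ rest) R))
    ≡⟨ cong (size x + sizes rest +_) (sum-sizes-map-∷ rest R) ⟩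
  size x + sizes rest + (sum (map size R) + length R * sizes rest)
    ≡⟨ regroup (size x) (sizes rest) (sum (map size R)) (length R) ⟩
  size x + sum (map size R) + (sizes rest + length R * sizes rest)
    ∎
  where
  open ≡-Reasoning
  regroup : ∀ x r S l → x + r + (S + l * r) ≡ x + S + (r + l * r)
  regroup = solve-∀

sum-sizes-concatMap-extensions : ∀ R L → sum (map sizes (concatMap (extensions R) L)) ≡
                                 length L * sum (map size R) + suc (length R) * sum (map sizes L)
sum-sizes-concatMap-extensions R []      = sym (*-zeroʳ (suc (length R)))
sum-sizes-concatMap-extensions R (r ∷ L) = begin
  sum (map sizes (extensions R r ++ concatMap (extensions R) L))
    ≡⟨ cong sum (map-++ sizes (extensions R r) (concatMap (extensions R) L)) ⟩
  sum (map sizes (extensions R r) ++ map sizes (concatMap (extensions R) L))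
    ≡⟨ sum-++ (map sizes (extensions R r)) (map sizes (concatMap (extensions R) L)) ⟩
  sizes r + sum (map sizes (map (_∷ r) R)) + sum (map sizes (concatMap (extensions R) L))
    ≡⟨ cong₂ (λ x y → sizes r + x + y) (sum-sizes-map-∷ r R) (sum-sizes-concatMap-extensions R L) ⟩
  sizes r + (S + l * sizes r) + (length L * S + suc l * sum (map sizes L))
    ≡⟨ regroup (sizes r) S l (length L) (sum (map sizes L)) ⟩
  suc (length L) * S + suc l * (sizes r + sum (map sizes L))
    ∎
  where
  open ≡-Reasoning
  S = sum (map size R)
  l = length R
  regroup : ∀ x S l k y → x + (S + l * x) + (k * S + suc l * y) ≡ suc k * S + suc l * (x + y)
  regroup = solve-∀

sum-size-map-node : ∀ L → sum (map size (map node L)) ≡ length L + sum (map sizes L)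
sum-size-map-node []      = refl
sum-size-map-node (x ∷ L) = cong suc (begin
  sizes x + sum (map size (map node L))      ≡⟨ cong (sizes x +_) (sum-size-map-node L) ⟩
  sizes x + (length L + sum (map sizes L))   ≡⟨ regroup (sizes x) (length L) (sum (map sizes L)) ⟩
  length L + (sizes x + sum (map sizes L))   ∎)
  where
  open ≡-Reasoning
  regroup : ∀ x l y → x + (l + y) ≡ l + (x + y)
  regroup = solve-∀

length≤sum-size : ∀ L → length L ≤ sum (map size L)
length≤sum-size []           = z≤n
length≤sum-size (node _ ∷ L) = s≤s (≤-trans (length≤sum-size L) (m≤n+m _ _))

mutual
  defect-forest : ∀ ts → DefectBound (length (choices ts)) (sum (map sizes (choices ts))) (sizes ts)
  defect-forest []       = defectBound ≤-refl
  defect-forest (x ∷ ts) =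
    subst₂ (λ c u → DefectBound c u (sizes (x ∷ ts)))
      (sym (length-concatMap-extensions (rootSubtrees x) (choices ts)))
      (sym (sum-sizes-concatMap-extensions (rootSubtrees x) (choices ts)))
      (DefectBound-* (DefectBound-branch (length≤sum-size (rootSubtrees x)) (defect-tree x))
                     (defect-forest ts))

  defect-tree : ∀ T → DefectBound (s T) (t T) (size T)
  defect-tree (node ts) =
    subst₂ (λ c u → DefectBound c u (size (node ts)))
      (sym (length-map node (choices ts)))
      (sym (sum-size-map-node (choices ts)))
      (DefectBound-root (defect-forest ts))

lemma4p2 : (T : RTree) → s T ^ s T * 4 ^ t T ≤ 4 ^ (size T * s T)
lemma4p2 T = DefectBound.bound (defect-tree T)
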